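{- Let $S\subseteq\mathbb{Z}^+$, $S'=\{s-1:s\in S\}$, and let $U$ be a set with $n$ elements, $n,k,r\ge0$. Then ${n\brace k}_{S,r}$ equals the number of composition-partition pairs $(\mathbf{V},\pi)$ over $U$ such that every component of $\mathbf{V}$ has cardinality in $S'$, and $\pi$ has exactly $k$ blocks, each of cardinality in $S$.
   Context: ${n\brace k}_{S,r}$ is the number of partitions of $[n+r]$ into $k+r$ non-empty blocks with $1,\dots,r$ in distinct blocks and all block sizes in $S$. An $r$-composition of a set $V$ is an $r$-tuple $\mathbf{V}=(V_1,\dots,V_r)$ of pairwise disjoint, possibly empty sets with union $V$. A composition-partition pair over $U$ is a pair $(\mathbf{V},\pi)$ where $\mathbf{V}$ is an $r$-composition of some subset $V\subseteq U$ and $\pi$ is a set partition of $U\setminus V$. -}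

module Defs where

open import Data.Bool using (Bool; true; false; _∧_; _∨_; not; if_then_else_)
open import Data.Nat using (ℕ; zero; suc; _+_; _≡ᵇ_; _<ᵇ_)
open import Data.Fin using (Fin; _↑ˡ_; toℕ)
open import Data.Fin.Properties using (_≟_)
open import Data.Maybe using (Maybe; nothing; just; is-nothing)
open import Data.List using (List; []; _∷_; [_]; map; concatMap; allFin; filterᵇ; length)
open import Data.Bool.ListAction using (all; any)
open import Data.Product using (_×_; _,_; proj₁; proj₂)
open import Data.Vec using (Vec; []; _∷_; lookup)
open import Relation.Nullary.Decidable using (⌊_⌋)

_⇒ᵇ_ : Bool → Bool → Bool
a ⇒ᵇ b = not a ∨ b

∀ᶠ : {m : ℕ} → (Fin m → Bool) → Bool
∀ᶠ {m} p = all p (allFin m)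

∃ᶠ : {m : ℕ} → (Fin m → Bool) → Bool
∃ᶠ {m} p = any p (allFin m)

countᶠ : {m : ℕ} → (Fin m → Bool) → ℕ
countᶠ {m} p = length (filterᵇ p (allFin m))

allVecs : {A : Set} → List A → (n : ℕ) → List (Vec A n)
allVecs xs zero = [ [] ]
allVecs xs (suc n) = concatMap (λ x → map (x ∷_) (allVecs xs n)) xs

Subsetℕ : Set
Subsetℕ = ℕ → Bool

-- Binary relations on Fin m, as Boolean matrices (finitely enumerable)

BRel : ℕ → Set
BRel m = Vec (Vec Bool m) m

rel : {m : ℕ} → BRel m → Fin m → Fin m → Bool
rel M u v = lookup (lookup M u) v

allBRel : (m : ℕ) → List (BRel m)
allBRel m = allVecs (allVecs (true ∷ false ∷ []) m) m

-- A set partition of the subset D ⊆ Fin m, represented (as usual) by its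
-- equivalence relation "lie in the same block": M is an equivalence relation
-- on D and relates no element outside D.
IsPartitionOf : {m : ℕ} → (Fin m → Bool) → BRel m → Bool
IsPartitionOf D M =
  ∀ᶠ (λ u → ∀ᶠ (λ v → rel M u v ⇒ᵇ (D u ∧ D v)))
  ∧ ∀ᶠ (λ u → D u ⇒ᵇ rel M u u)
  ∧ ∀ᶠ (λ u → ∀ᶠ (λ v → rel M u v ⇒ᵇ rel M v u))
  ∧ ∀ᶠ (λ u → ∀ᶠ (λ v → ∀ᶠ (λ w → (rel M u v ∧ rel M v w) ⇒ᵇ rel M u w)))

blockSize : {m : ℕ} → BRel m → Fin m → ℕ
blockSize M u = countᶠ (λ v → rel M u v)

-- u is the least element of its block (one such element per block)
isBlockLeader : {m : ℕ} → (Fin m → Bool) → BRel m → Fin m → Bool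
isBlockLeader D M u = D u ∧ not (∃ᶠ (λ v → (toℕ v <ᵇ toℕ u) ∧ rel M v u))

numBlocks : {m : ℕ} → (Fin m → Bool) → BRel m → ℕ
numBlocks D M = countᶠ (isBlockLeader D M)

blockSizesIn : {m : ℕ} → Subsetℕ → (Fin m → Bool) → BRel m → Bool
blockSizesIn S D M = ∀ᶠ (λ u → D u ⇒ᵇ S (blockSize M u))

-- The r-Stirling numbers with block sizes restricted to S:
-- number of partitions of [n+r] (here Fin (r + n), the special elements
-- 1,…,r being the first r elements i ↑ˡ n) into k + r blocks, with the
-- first r elements in distinct blocks and all block sizes in S.

everywhere : {m : ℕ} → Fin m → Bool
everywhere _ = true

isRStirlingPartition : Subsetℕ → (n k r : ℕ) → BRel (r + n) → Bool
isRStirlingPartition S n k r M =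
  IsPartitionOf everywhere M
  ∧ (numBlocks everywhere M ≡ᵇ (k + r))
  ∧ blockSizesIn S everywhere M
  ∧ ∀ᶠ (λ (i : Fin r) → ∀ᶠ (λ (j : Fin r) →
        not ⌊ i ≟ j ⌋ ⇒ᵇ not (rel M (i ↑ˡ n) (j ↑ˡ n))))

rStirlingS : Subsetℕ → (n k r : ℕ) → ℕ
rStirlingS S n k r = length (filterᵇ (isRStirlingPartition S n k r) (allBRel (r + n)))

-- The r-composition V = (V_1,…,V_r) of V ⊆ U is given by
-- c : Vec (Maybe (Fin r)) n with  u ∈ V_i  ⇔  c u = just i,
-- and u ∉ V ⇔ c u = nothing.  π is a set partition of U ∖ V.

CompPartPair : (n r : ℕ) → Set
CompPartPair n r = Vec (Maybe (Fin r)) n × BRel n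

allMaybeFin : (r : ℕ) → List (Maybe (Fin r))
allMaybeFin r = nothing ∷ map just (allFin r)

allCompPartPairs : (n r : ℕ) → List (CompPartPair n r)
allCompPartPairs n r =
  concatMap (λ c → map (c ,_) (allBRel n)) (allVecs (allMaybeFin r) n)

inComponent : {n r : ℕ} → Vec (Maybe (Fin r)) n → Fin r → Fin n → Bool
inComponent c i u with lookup c u
... | nothing = false
... | just j  = ⌊ i ≟ j ⌋

notInV : {n r : ℕ} → Vec (Maybe (Fin r)) n → Fin n → Bool
notInV c u = is-nothing (lookup c u)

-- |V_i| ∈ S'  where S' = {s - 1 : s ∈ S}, i.e.  |V_i| + 1 ∈ S  (as S ⊆ ℤ⁺)
inS' : Subsetℕ → ℕ → Bool
inS' S t = S (suc t)

isGoodPair : Subsetℕ → (n k r : ℕ) → CompPartPair n r → Bool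
isGoodPair S n k r (c , M) =
  ∀ᶠ (λ (i : Fin r) → inS' S (countᶠ (inComponent c i)))
  ∧ IsPartitionOf (notInV c) M
  ∧ (numBlocks (notInV c) M ≡ᵇ k)
  ∧ blockSizesIn S (notInV c) M

numGoodPairs : Subsetℕ → (n k r : ℕ) → ℕ
numGoodPairs S n k r = length (filterᵇ (isGoodPair S n k r) (allCompPartPairs n r))

module Submission where

-- The proof is a bijection.  In a partition M of Fin (r + n) counted by rStirlingS the r
-- special points lie in distinct blocks.  Labelling every ordinary point u by the special
-- point whose block contains it (if any) gives an r-composition V with |V_i| + 1 = size of
-- the block of i, and the blocks free of special points form a partition N of U ∖ V;
-- conversely, gluing each V_i to special point i and keeping N rebuilds M.

open import Defs
open import Data.Bool using (Bool; true; false; T; not; _∧_; _∨_; if_then_else_)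
open import Data.Bool.Properties using (T?; T-∧; T-∨; ∨-identityʳ)
open import Data.Nat using (ℕ; zero; suc; _+_; _≡ᵇ_; _<ᵇ_; _<_)
open import Data.Nat.Properties
  using (+-assoc; ≡ᵇ⇒≡; ≡⇒≡ᵇ; <ᵇ⇒<; <⇒<ᵇ; <-irrefl; <-asym; ≤-trans; m≤m+n; +-monoʳ-<; +-cancelˡ-<; +-comm; +-cancelˡ-≡)
open import Data.Fin using (Fin; zero; suc; _↑ˡ_; _↑ʳ_; toℕ; splitAt; join)
open import Data.Fin.Properties using (_≟_; suc-injective; 0≢1+n; any?; splitAt-join; join-splitAt; toℕ-↑ˡ; toℕ-↑ʳ; toℕ<n)
open import Data.Maybe using (Maybe; nothing; just; is-nothing)
open import Data.Maybe.Properties using (just-injective)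
open import Data.List using (List; []; _∷_; map; _++_; length; filterᵇ; concatMap; cartesianProductWith; allFin; tabulate)
open import Data.List.Properties using (length-map; map-∘; map-id-local; map-tabulate; length-tabulate; filter-≐; filter-none; filter-all)
open import Data.List.Relation.Unary.All as All using ([]; _∷_)
open import Data.List.Relation.Unary.All.Properties using (all-filter; all⁺; all⁻)
open import Data.List.Relation.Unary.Any as Any using (here; there)
open import Data.List.Relation.Unary.Any.Properties using (any⁺; any⁻)
open import Data.List.Relation.Unary.AllPairs using ([]; _∷_)
open import Data.List.Relation.Unary.Unique.Propositional using (Unique)
import Data.List.Relation.Unary.Unique.Propositional.Properties as Unique
open import Data.List.Membership.Propositional using (_∈_; lose)
open import Data.List.Membership.Propositional.Properties
  using (∈-map⁺; ∈-map⁻; ∈-filter⁺; ∈-filter⁻; ∈-allFin; ∈-cartesianProductWith⁺)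
open import Data.List.Membership.Propositional.Properties.WithK using (unique∧set⇒bag)
open import Data.List.Relation.Binary.BagAndSetEquality using (∼bag⇒↭)
open import Data.List.Relation.Binary.Permutation.Propositional.Properties using (↭-length)
open import Data.Product using (_×_; _,_; proj₁; proj₂; ∃; uncurry)
open import Data.Unit using (tt)
open import Data.Empty using (⊥-elim)
open import Data.Sum using (_⊎_; inj₁; inj₂)
open import Relation.Nullary using (¬_; yes; no)
open import Relation.Nullary.Decidable using (⌊_⌋; toWitness; fromWitness; toWitnessFalse; fromWitnessFalse; decidable-stable)
open import Data.Vec as Vec using (Vec)
open import Data.Vec.Properties using (∷-injective; lookup∘tabulate; tabulate∘lookup; tabulate-cong)
open import Function using (_∘_; id; _⇔_; mk⇔; Equivalence)
import Function.Properties.Equivalence as ⇔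
open import Relation.Binary.PropositionalEquality
  using (_≡_; _≢_; refl; sym; trans; cong; cong₂; subst; module ≡-Reasoning)

-- If f and g are mutually inverse between the
-- p-elements of a complete duplicate-free enumeration xs of A and the q-elements
-- of such an enumeration ys of B, the two filtered lists have the same length:
-- the image of the first filter is duplicate-free and has exactly the elements of
-- the second, so the two are permutations of each other.
count-bijection :
  {A B : Set} {xs : List A} {ys : List B} → Unique xs → Unique ys → (∀ a → a ∈ xs) → (∀ b → b ∈ ys) →
  (p : A → Bool) (q : B → Bool) (f : A → B) (g : B → A) →
  (∀ {a} → T (p a) → T (q (f a))) → (∀ {b} → T (q b) → T (p (g b))) →
  (∀ {a} → T (p a) → g (f a) ≡ a) → (∀ {b} → T (q b) → f (g b) ≡ b) →
  length (filterᵇ p xs) ≡ length (filterᵇ q ys)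
count-bijection {xs = xs} {ys} unique-xs unique-ys complete-xs complete-ys p q f g pq qp gf fg = begin
  length (filterᵇ p xs)          ≡⟨ sym (length-map f (filterᵇ p xs)) ⟩
  length (map f (filterᵇ p xs))  ≡⟨ ↭-length (∼bag⇒↭ (unique∧set⇒bag unique-image unique-target same-elements)) ⟩
  length (filterᵇ q ys)          ∎
  where
  open ≡-Reasoning
  unique-target : Unique (filterᵇ q ys)
  unique-target = Unique.filter⁺ (T? ∘ q) unique-ys
  g-retracts : map g (map f (filterᵇ p xs)) ≡ filterᵇ p xs
  g-retracts = trans (sym (map-∘ (filterᵇ p xs)))
                     (map-id-local (All.map gf (all-filter (T? ∘ p) xs)))
  unique-image : Unique (map f (filterᵇ p xs))
  unique-image = Unique.map⁻ (subst Unique (sym g-retracts) (Unique.filter⁺ (T? ∘ p) unique-xs))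
  same-elements : ∀ {b} → (b ∈ map f (filterᵇ p xs)) ⇔ (b ∈ filterᵇ q ys)
  same-elements = mk⇔ to from
    where
    to : ∀ {b} → b ∈ map f (filterᵇ p xs) → b ∈ filterᵇ q ys
    to b∈ with ∈-map⁻ f b∈
    ... | a , a∈ , refl = ∈-filter⁺ (T? ∘ q) (complete-ys (f a)) (pq (proj₂ (∈-filter⁻ (T? ∘ p) {xs = xs} a∈)))
    from : ∀ {b} → b ∈ filterᵇ q ys → b ∈ map f (filterᵇ p xs)
    from {b} b∈ with ∈-filter⁻ (T? ∘ q) {xs = ys} b∈
    ... | _ , qb = subst (_∈ map f (filterᵇ p xs)) (fg qb)
                     (∈-map⁺ f (∈-filter⁺ (T? ∘ p) (complete-xs (g b)) (qp qb)))

concatMap-map≡cartesianProductWith : {A B C : Set} (f : A → B → C) (xs : List A) (ys : List B) →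
  concatMap (λ x → map (f x) ys) xs ≡ cartesianProductWith f xs ys
concatMap-map≡cartesianProductWith f [] ys = refl
concatMap-map≡cartesianProductWith f (x ∷ xs) ys =
  cong (map (f x) ys ++_) (concatMap-map≡cartesianProductWith f xs ys)

allVecs-unique : {A : Set} {xs : List A} (n : ℕ) → Unique xs → Unique (allVecs xs n)
allVecs-unique zero unique-xs = [] ∷ []
allVecs-unique {xs = xs} (suc n) unique-xs =
  subst Unique (sym (concatMap-map≡cartesianProductWith Vec._∷_ xs (allVecs xs n)))
    (Unique.cartesianProductWith⁺ Vec._∷_ ∷-injective unique-xs (allVecs-unique n unique-xs))

allVecs-complete : {A : Set} {xs : List A} (n : ℕ) → (∀ a → a ∈ xs) → ∀ v → v ∈ allVecs xs n
allVecs-complete zero complete-xs Vec.[] = here refl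
allVecs-complete {xs = xs} (suc n) complete-xs (a Vec.∷ v) =
  subst (_ ∈_) (sym (concatMap-map≡cartesianProductWith Vec._∷_ xs (allVecs xs n)))
    (∈-cartesianProductWith⁺ Vec._∷_ (complete-xs a) (allVecs-complete n complete-xs v))

allBRel-unique : ∀ m → Unique (allBRel m)
allBRel-unique m = allVecs-unique m (allVecs-unique m (((λ ()) ∷ []) ∷ [] ∷ []))

allBRel-complete : ∀ m M → M ∈ allBRel m
allBRel-complete m = allVecs-complete m (allVecs-complete m bool∈)
  where
  bool∈ : ∀ b → b ∈ true ∷ false ∷ []
  bool∈ true = here refl
  bool∈ false = there (here refl)

allMaybeFin-unique : ∀ r → Unique (allMaybeFin r)
allMaybeFin-unique r = All.tabulate nothing∉ ∷ Unique.map⁺ just-injective (Unique.allFin⁺ r)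
  where
  nothing∉ : ∀ {x} → x ∈ map just (allFin r) → nothing ≢ x
  nothing∉ x∈ refl with ∈-map⁻ just x∈
  ... | _ , _ , ()

allMaybeFin-complete : ∀ r x → x ∈ allMaybeFin r
allMaybeFin-complete r nothing = here refl
allMaybeFin-complete r (just i) = there (∈-map⁺ just (∈-allFin i))

allCompPartPairs-unique : ∀ n r → Unique (allCompPartPairs n r)
allCompPartPairs-unique n r =
  subst Unique (sym (concatMap-map≡cartesianProductWith _,_ (allVecs (allMaybeFin r) n) (allBRel n)))
    (Unique.cartesianProductWith⁺ _,_ pair-injective
       (allVecs-unique n (allMaybeFin-unique r)) (allBRel-unique n))
  where
  pair-injective : {A B : Set} {a a′ : A} {b b′ : B} → (a , b) ≡ (a′ , b′) → a ≡ a′ × b ≡ b′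
  pair-injective refl = refl , refl

allCompPartPairs-complete : ∀ n r P → P ∈ allCompPartPairs n r
allCompPartPairs-complete n r (c , M) =
  subst (_ ∈_) (sym (concatMap-map≡cartesianProductWith _,_ (allVecs (allMaybeFin r) n) (allBRel n)))
    (∈-cartesianProductWith⁺ _,_ (allVecs-complete n (allMaybeFin-complete r) c) (allBRel-complete n M))

T-ext : {a b : Bool} → (T a → T b) → (T b → T a) → a ≡ b
T-ext {false} {false} _ _ = refl
T-ext {false} {true}  _ b⇒a = ⊥-elim (b⇒a tt)
T-ext {true}  {false} a⇒b _ = ⊥-elim (a⇒b tt)
T-ext {true}  {true}  _ _ = refl

T-not : {a : Bool} → T (not a) ⇔ (¬ T a)
T-not {false} = mk⇔ (λ _ ()) (λ _ → tt)
T-not {true}  = mk⇔ (λ ()) (λ ¬t → ¬t tt)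

∧-intro : {a b : Bool} → T a → T b → T (a ∧ b)
∧-intro ta tb = Equivalence.from T-∧ (ta , tb)

∧-elim : {a b : Bool} → T (a ∧ b) → T a × T b
∧-elim = Equivalence.to T-∧

⇒ᵇ-elim : {a b : Bool} → T (a ⇒ᵇ b) → T a → T b
⇒ᵇ-elim {true} b _ = b

⇒ᵇ-intro : {a b : Bool} → (T a → T b) → T (a ⇒ᵇ b)
⇒ᵇ-intro {false} _ = tt
⇒ᵇ-intro {true}  f = f tt

∀ᶠ-sound : {m : ℕ} {p : Fin m → Bool} → T (∀ᶠ p) → ∀ u → T (p u)
∀ᶠ-sound {m} {p} h u = All.lookup (all⁺ p (allFin m) h) (∈-allFin u)

∀ᶠ-complete : {m : ℕ} {p : Fin m → Bool} → (∀ u → T (p u)) → T (∀ᶠ p)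
∀ᶠ-complete {m} {p} h = all⁻ p {xs = allFin m} (All.tabulate (λ {u} _ → h u))

∃ᶠ⇔ : {m : ℕ} {p : Fin m → Bool} → T (∃ᶠ p) ⇔ (∃ λ u → T (p u))
∃ᶠ⇔ {m} {p} = mk⇔ (λ h → Any.satisfied (any⁻ p (allFin m) h))
                   (λ (u , pu) → any⁺ p (lose (∈-allFin u) pu))

countᶠ-cong : {m : ℕ} {p q : Fin m → Bool} → (∀ u → p u ≡ q u) → countᶠ p ≡ countᶠ q
countᶠ-cong {m} {p} {q} p≗q =
  cong length (filter-≐ (T? ∘ p) (T? ∘ q) ((λ {u} → subst T (p≗q u)) , (λ {u} → subst T (sym (p≗q u)))) (allFin m))

countᶠ-none : {m : ℕ} (p : Fin m → Bool) → (∀ u → ¬ T (p u)) → countᶠ p ≡ 0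
countᶠ-none {m} p none = cong length (filter-none (T? ∘ p) {xs = allFin m} (All.tabulate (λ {u} _ → none u)))

count-tail : {m : ℕ} (p : Fin (suc m) → Bool) → length (filterᵇ p (tabulate suc)) ≡ countᶠ (p ∘ suc)
count-tail {m} p = trans (cong (length ∘ filterᵇ p) (sym (map-tabulate id suc))) (count-map-suc (allFin m))
  where
  count-map-suc : ∀ us → length (filterᵇ p (map suc us)) ≡ length (filterᵇ (p ∘ suc) us)
  count-map-suc [] = refl
  count-map-suc (u ∷ us) with p (suc u)
  ... | true  = cong suc (count-map-suc us)
  ... | false = count-map-suc us

countᶠ-suc : {m : ℕ} (p : Fin (suc m) → Bool) → countᶠ p ≡ (if p zero then 1 else 0) + countᶠ (p ∘ suc)
countᶠ-suc p with p zero
... | true  = cong suc (count-tail p)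
... | false = count-tail p

countᶠ-all : {m : ℕ} (p : Fin m → Bool) → (∀ u → T (p u)) → countᶠ p ≡ m
countᶠ-all {m} p all-p =
  trans (cong length (filter-all (T? ∘ p) {xs = allFin m} (All.tabulate (λ {u} _ → all-p u))))
        (length-tabulate id)

countᶠ-single : {m : ℕ} (p : Fin m → Bool) (i : Fin m) → T (p i) → (∀ u → T (p u) → u ≡ i) → countᶠ p ≡ 1
countᶠ-single p zero p-zero only-zero = begin
  countᶠ p                                          ≡⟨ countᶠ-suc p ⟩
  (if p zero then 1 else 0) + countᶠ (p ∘ suc)      ≡⟨ cong₂ (λ b k → (if b then 1 else 0) + k)
                                                         (T-ext (λ _ → tt) (λ _ → p-zero))
                                                         (countᶠ-none (p ∘ suc) (λ u pu → 0≢1+n (sym (only-zero (suc u) pu)))) ⟩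
  1                                                 ∎
  where open ≡-Reasoning
countᶠ-single p (suc i) p-i only-i = begin
  countᶠ p                                          ≡⟨ countᶠ-suc p ⟩
  (if p zero then 1 else 0) + countᶠ (p ∘ suc)      ≡⟨ cong₂ (λ b k → (if b then 1 else 0) + k)
                                                         (T-ext (λ p0 → 0≢1+n (only-i zero p0)) ⊥-elim)
                                                         (countᶠ-single (p ∘ suc) i p-i
                                                           (λ u pu → suc-injective (only-i (suc u) pu))) ⟩
  1                                                 ∎
  where open ≡-Reasoning

countᶠ-split : (r n : ℕ) (p : Fin (r + n) → Bool) → countᶠ p ≡ countᶠ (p ∘ (_↑ˡ n)) + countᶠ (p ∘ (r ↑ʳ_))
countᶠ-split zero    n p = refl
countᶠ-split (suc r) n p = begin
  countᶠ p                                                   ≡⟨ countᶠ-suc p ⟩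
  b + countᶠ (p ∘ suc)                                        ≡⟨ cong (b +_) (countᶠ-split r n (p ∘ suc)) ⟩
  b + (countᶠ (p ∘ suc ∘ (_↑ˡ n)) + countᶠ (p ∘ (suc r ↑ʳ_))) ≡⟨ sym (+-assoc b _ _) ⟩
  b + countᶠ (p ∘ suc ∘ (_↑ˡ n)) + countᶠ (p ∘ (suc r ↑ʳ_))   ≡⟨ cong (_+ countᶠ (p ∘ (suc r ↑ʳ_)))
                                                                     (sym (countᶠ-suc (p ∘ (_↑ˡ n)))) ⟩
  countᶠ (p ∘ (_↑ˡ n)) + countᶠ (p ∘ (suc r ↑ʳ_))             ∎
  where
  open ≡-Reasoning
  b = if p zero then 1 else 0

-- Stated for relations on any type,
-- since the bijection builds such relations on Fin r ⊎ Fin n as well.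
record IsEquivalenceOn {A : Set} (D : A → Bool) (R : A → A → Bool) : Set where
  field
    support    : ∀ {x y} → T (R x y) → T (D x) × T (D y)
    reflexive  : ∀ {x} → T (D x) → T (R x x)
    symmetric  : ∀ {x y} → T (R x y) → T (R y x)
    transitive : ∀ {x y z} → T (R x y) → T (R y z) → T (R x z)

isPartitionOf⇔ : {m : ℕ} (D : Fin m → Bool) (M : BRel m) → T (IsPartitionOf D M) ⇔ IsEquivalenceOn D (rel M)
isPartitionOf⇔ D M = mk⇔ sound complete
  where
  support-part = ∀ᶠ (λ u → ∀ᶠ (λ v → rel M u v ⇒ᵇ (D u ∧ D v)))
  reflexive-part = ∀ᶠ (λ u → D u ⇒ᵇ rel M u u)
  symmetric-part = ∀ᶠ (λ u → ∀ᶠ (λ v → rel M u v ⇒ᵇ rel M v u))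
  sound : T (IsPartitionOf D M) → IsEquivalenceOn D (rel M)
  sound h =
    let sup , h₁ = ∧-elim {support-part} h
        rfl , h₂ = ∧-elim {reflexive-part} h₁
        sym′ , trans′ = ∧-elim {symmetric-part} h₂
    in record
    { support    = λ {x} {y} → ∧-elim ∘ ⇒ᵇ-elim (∀ᶠ-sound (∀ᶠ-sound sup x) y)
    ; reflexive  = λ {x} → ⇒ᵇ-elim (∀ᶠ-sound rfl x)
    ; symmetric  = λ {x} {y} → ⇒ᵇ-elim (∀ᶠ-sound (∀ᶠ-sound sym′ x) y)
    ; transitive = λ {x} {y} {z} xy yz → ⇒ᵇ-elim (∀ᶠ-sound (∀ᶠ-sound (∀ᶠ-sound trans′ x) y) z) (∧-intro xy yz)
    }
  complete : IsEquivalenceOn D (rel M) → T (IsPartitionOf D M)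
  complete e = ∧-intro {support-part} (∀ᶠ-complete λ x → ∀ᶠ-complete λ y → ⇒ᵇ-intro λ (xy : T (rel M x y)) →
                                         ∧-intro {D x} (proj₁ (support xy)) (proj₂ (support xy)))
              (∧-intro {reflexive-part} (∀ᶠ-complete λ x → ⇒ᵇ-intro (reflexive {x}))
              (∧-intro {symmetric-part} (∀ᶠ-complete λ x → ∀ᶠ-complete λ y → ⇒ᵇ-intro (symmetric {x} {y}))
                       (∀ᶠ-complete λ x → ∀ᶠ-complete λ y → ∀ᶠ-complete λ z →
                          ⇒ᵇ-intro λ xyz → let xy , yz = ∧-elim {rel M x y} xyz in transitive {x} {y} {z} xy yz)))
    where open IsEquivalenceOn e

record IsStirlingPartition (S : Subsetℕ) (n k r : ℕ) (M : BRel (r + n)) : Set where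
  field
    equivalence : IsEquivalenceOn everywhere (rel M)
    block-count : numBlocks everywhere M ≡ k + r
    block-sizes : ∀ x → T (S (blockSize M x))
    separated   : ∀ {i j} → T (rel M (i ↑ˡ n) (j ↑ˡ n)) → i ≡ j

isRStirlingPartition⇔ : (S : Subsetℕ) (n k r : ℕ) (M : BRel (r + n)) →
  T (isRStirlingPartition S n k r M) ⇔ IsStirlingPartition S n k r M
isRStirlingPartition⇔ S n k r M = mk⇔ sound complete
  where
  partition-part = IsPartitionOf everywhere M
  count-part = numBlocks everywhere M ≡ᵇ (k + r)
  sizes-part = blockSizesIn S everywhere M
  sound : T (isRStirlingPartition S n k r M) → IsStirlingPartition S n k r M
  sound h =
    let partition , h₁ = ∧-elim {partition-part} h
        count , h₂ = ∧-elim {count-part} h₁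
        sizes , separation = ∧-elim {sizes-part} h₂
    in record
    { equivalence = Equivalence.to (isPartitionOf⇔ everywhere M) partition
    ; block-count = ≡ᵇ⇒≡ _ _ count
    ; block-sizes = λ x → ⇒ᵇ-elim (∀ᶠ-sound sizes x) tt
    ; separated   = λ {i} {j} rij → decidable-stable (i ≟ j) λ i≢j →
        Equivalence.to T-not (⇒ᵇ-elim (∀ᶠ-sound (∀ᶠ-sound separation i) j) (fromWitnessFalse i≢j)) rij
    }
  complete : IsStirlingPartition S n k r M → T (isRStirlingPartition S n k r M)
  complete s = ∧-intro {partition-part} (Equivalence.from (isPartitionOf⇔ everywhere M) equivalence)
              (∧-intro {count-part} (≡⇒≡ᵇ _ _ block-count)
              (∧-intro {sizes-part} (∀ᶠ-complete λ x → ⇒ᵇ-intro (λ _ → block-sizes x))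
                       (∀ᶠ-complete λ i → ∀ᶠ-complete λ j → ⇒ᵇ-intro λ (i≢j : T (not ⌊ i ≟ j ⌋)) →
                          Equivalence.from T-not (λ rij → toWitnessFalse i≢j (separated rij)))))
    where open IsStirlingPartition s

record IsGoodPair (S : Subsetℕ) (n k r : ℕ) (c : Vec (Maybe (Fin r)) n) (N : BRel n) : Set where
  field
    component-sizes : ∀ i → T (S (suc (countᶠ (inComponent c i))))
    equivalence     : IsEquivalenceOn (notInV c) (rel N)
    block-count     : numBlocks (notInV c) N ≡ k
    block-sizes     : ∀ {u} → T (notInV c u) → T (S (blockSize N u))

isGoodPair⇔ : (S : Subsetℕ) (n k r : ℕ) (c : Vec (Maybe (Fin r)) n) (N : BRel n) →
  T (isGoodPair S n k r (c , N)) ⇔ IsGoodPair S n k r c N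
isGoodPair⇔ S n k r c N = mk⇔ sound complete
  where
  components-part = ∀ᶠ (λ (i : Fin r) → inS' S (countᶠ (inComponent c i)))
  partition-part = IsPartitionOf (notInV c) N
  count-part = numBlocks (notInV c) N ≡ᵇ k
  sound : T (isGoodPair S n k r (c , N)) → IsGoodPair S n k r c N
  sound h =
    let components , h₁ = ∧-elim {components-part} h
        partition , h₂ = ∧-elim {partition-part} h₁
        count , sizes = ∧-elim {count-part} h₂
    in record
    { component-sizes = ∀ᶠ-sound components
    ; equivalence     = Equivalence.to (isPartitionOf⇔ (notInV c) N) partition
    ; block-count     = ≡ᵇ⇒≡ _ _ count
    ; block-sizes     = λ {u} → ⇒ᵇ-elim (∀ᶠ-sound sizes u)
    }
  complete : IsGoodPair S n k r c N → T (isGoodPair S n k r (c , N))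
  complete g = ∧-intro {components-part} (∀ᶠ-complete component-sizes)
              (∧-intro {partition-part} (Equivalence.from (isPartitionOf⇔ (notInV c) N) equivalence)
              (∧-intro {count-part} (≡⇒≡ᵇ _ _ block-count)
                       (∀ᶠ-complete λ u → ⇒ᵇ-intro (block-sizes {u}))))
    where open IsGoodPair g

isBlockLeader⇔ : {m : ℕ} (D : Fin m → Bool) (M : BRel m) (u : Fin m) →
  T (isBlockLeader D M u) ⇔ (T (D u) × (∀ v → toℕ v < toℕ u → ¬ T (rel M v u)))
isBlockLeader⇔ D M u = mk⇔ to from
  where
  to : T (isBlockLeader D M u) → T (D u) × (∀ v → toℕ v < toℕ u → ¬ T (rel M v u))
  to h = proj₁ (∧-elim {D u} h) , λ v v<u rvu →
    Equivalence.to T-not (proj₂ (∧-elim {D u} h)) (Equivalence.from ∃ᶠ⇔ (v , ∧-intro (<⇒<ᵇ v<u) rvu))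
  from : T (D u) × (∀ v → toℕ v < toℕ u → ¬ T (rel M v u)) → T (isBlockLeader D M u)
  from (du , no-earlier) = ∧-intro {D u} du (Equivalence.from T-not λ earlier →
    let v , pv = Equivalence.to ∃ᶠ⇔ earlier
        v<u , rvu = ∧-elim {toℕ v <ᵇ toℕ u} pv
    in no-earlier v (<ᵇ⇒< _ _ v<u) rvu)

tabulateRel : {m : ℕ} → (Fin m → Fin m → Bool) → BRel m
tabulateRel f = Vec.tabulate (λ u → Vec.tabulate (f u))

rel-tabulateRel : {m : ℕ} (f : Fin m → Fin m → Bool) (u v : Fin m) → rel (tabulateRel f) u v ≡ f u v
rel-tabulateRel f u v rewrite lookup∘tabulate (λ u → Vec.tabulate (f u)) u = lookup∘tabulate (f u) v

Vec-ext : {A : Set} {m : ℕ} {xs ys : Vec A m} → (∀ u → Vec.lookup xs u ≡ Vec.lookup ys u) → xs ≡ ys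
Vec-ext {xs = xs} {ys} eq = trans (sym (tabulate∘lookup xs)) (trans (tabulate-cong eq) (tabulate∘lookup ys))

BRel-ext : {m : ℕ} {M M′ : BRel m} → (∀ u v → rel M u v ≡ rel M′ u v) → M ≡ M′
BRel-ext eq = Vec-ext λ u → Vec-ext (eq u)

same : {r : ℕ} → Maybe (Fin r) → Maybe (Fin r) → Bool
same (just i) (just j) = ⌊ i ≟ j ⌋
same _        _        = false

same⇔ : {r : ℕ} (a b : Maybe (Fin r)) → T (same a b) ⇔ (∃ λ j → a ≡ just j × b ≡ just j)
same⇔ a b = mk⇔ (to a b) from
  where
  to : ∀ a b → T (same a b) → ∃ λ j → a ≡ just j × b ≡ just j
  to (just i) (just j) i≡j = j , cong just (toWitness i≡j) , refl
  from : (∃ λ j → a ≡ just j × b ≡ just j) → T (same a b)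
  from (j , refl , refl) = fromWitness refl

same-justˡ : {r : ℕ} (i : Fin r) (b : Maybe (Fin r)) → T (same (just i) b) ⇔ (b ≡ just i)
same-justˡ i b = mk⇔
  (λ ib → let _ , i≡ , b≡ = Equivalence.to (same⇔ (just i) b) ib in trans b≡ (sym i≡))
  (λ b≡ → Equivalence.from (same⇔ (just i) b) (i , refl , b≡))

same-justʳ : {r : ℕ} (a : Maybe (Fin r)) (j : Fin r) → T (same a (just j)) ⇔ (a ≡ just j)
same-justʳ a j = mk⇔
  (λ aj → let _ , a≡ , j≡ = Equivalence.to (same⇔ a (just j)) aj in trans a≡ (sym j≡))
  (λ a≡ → Equivalence.from (same⇔ a (just j)) (j , a≡ , refl))

inComponent-same : {n r : ℕ} (c : Vec (Maybe (Fin r)) n) (i : Fin r) (u : Fin n) →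
  inComponent c i u ≡ same (just i) (Vec.lookup c u)
inComponent-same c i u with Vec.lookup c u
... | nothing = refl
... | just _  = refl

witness : {r : ℕ} → (Fin r → Bool) → Maybe (Fin r)
witness p with any? (λ i → T? (p i))
... | yes (i , _) = just i
... | no  _       = nothing

witness-holds : {r : ℕ} (p : Fin r → Bool) {i : Fin r} → witness p ≡ just i → T (p i)
witness-holds p eq with any? (λ i → T? (p i))
witness-holds p refl | yes (_ , pi) = pi

witness-unique : {r : ℕ} (p : Fin r → Bool) → (∀ {i j} → T (p i) → T (p j) → i ≡ j) →
  ∀ {i} → T (p i) → witness p ≡ just i
witness-unique p unique {i} pi with any? (λ i → T? (p i))
... | yes (j , pj) = cong just (unique pj pi)
... | no  none     = ⊥-elim (none (i , pi))

witness-none : {r : ℕ} (p : Fin r → Bool) → (∀ i → ¬ T (p i)) → witness p ≡ nothing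
witness-none p none with any? (λ i → T? (p i))
... | yes (i , pi) = ⊥-elim (none i pi)
... | no  _        = refl

equivalence-pullback : {A B : Set} {D : A → Bool} {R : A → A → Bool} {R′ : B → B → Bool} (h : B → A) →
  (∀ x y → R′ x y ≡ R (h x) (h y)) → IsEquivalenceOn D R → IsEquivalenceOn (D ∘ h) R′
equivalence-pullback {R = R} {R′ = R′} h R′≡ e = record
  { support    = support ∘ to
  ; reflexive  = from ∘ reflexive
  ; symmetric  = from ∘ symmetric ∘ to
  ; transitive = λ xy yz → from (transitive (to xy) (to yz))
  }
  where
  open IsEquivalenceOn e
  to : ∀ {x y} → T (R′ x y) → T (R (h x) (h y))
  to {x} {y} = subst T (R′≡ x y)
  from : ∀ {x y} → T (R (h x) (h y)) → T (R′ x y)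
  from {x} {y} = subst T (sym (R′≡ x y))

is-nothing⇔ : {A : Set} {x : Maybe A} → T (is-nothing x) ⇔ (x ≡ nothing)
is-nothing⇔ {x = nothing} = mk⇔ (λ _ → refl) (λ _ → tt)
is-nothing⇔ {x = just _}  = mk⇔ (λ ()) (λ ())

is-nothing-just : {A : Set} {x : Maybe A} {a : A} → x ≡ just a → ¬ T (is-nothing x)
is-nothing-just refl ()

-- Gluing by labels: if R is an equivalence relation on the unlabelled points, then
-- "related by R or carrying the same label" is an equivalence relation on all points.
-- (R never touches a labelled point, so the two kinds of relatedness never chain.)
labelled-union-equivalence : {A : Set} {r : ℕ} (ℓ : A → Maybe (Fin r)) (R : A → A → Bool) →
  IsEquivalenceOn (is-nothing ∘ ℓ) R → IsEquivalenceOn (λ _ → true) (λ x y → R x y ∨ same (ℓ x) (ℓ y))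
labelled-union-equivalence ℓ R e = record
  { support    = λ _ → tt , tt
  ; reflexive  = λ {x} _ → reflexive′ x (ℓ x) refl
  ; symmetric  = λ xy → Equivalence.from T-∨ (symmetric′ (Equivalence.to T-∨ xy))
  ; transitive = λ {x} {y} xy yz → Equivalence.from T-∨ (transitive′ (Equivalence.to T-∨ xy) (Equivalence.to T-∨ yz))
  }
  where
  open IsEquivalenceOn e
  reflexive′ : ∀ x a → ℓ x ≡ a → T (R x x ∨ same (ℓ x) (ℓ x))
  reflexive′ x nothing  eq = Equivalence.from T-∨ (inj₁ (reflexive (Equivalence.from is-nothing⇔ eq)))
  reflexive′ x (just j) eq = Equivalence.from T-∨ (inj₂ (Equivalence.from (same⇔ (ℓ x) (ℓ x)) (j , eq , eq)))
  symmetric′ : ∀ {x y} → T (R x y) ⊎ T (same (ℓ x) (ℓ y)) → T (R y x) ⊎ T (same (ℓ y) (ℓ x))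
  symmetric′ (inj₁ xy) = inj₁ (symmetric xy)
  symmetric′ {x} {y} (inj₂ xy) with Equivalence.to (same⇔ (ℓ x) (ℓ y)) xy
  ... | j , x-j , y-j = inj₂ (Equivalence.from (same⇔ (ℓ y) (ℓ x)) (j , y-j , x-j))
  transitive′ : ∀ {x y z} → T (R x y) ⊎ T (same (ℓ x) (ℓ y)) → T (R y z) ⊎ T (same (ℓ y) (ℓ z)) →
    T (R x z) ⊎ T (same (ℓ x) (ℓ z))
  transitive′ (inj₁ xy) (inj₁ yz) = inj₁ (transitive xy yz)
  transitive′ {y = y} {z} (inj₁ xy) (inj₂ yz) =
    ⊥-elim (is-nothing-just (proj₁ (proj₂ (Equivalence.to (same⇔ (ℓ y) (ℓ z)) yz))) (proj₂ (support xy)))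
  transitive′ {x} {y} (inj₂ xy) (inj₁ yz) =
    ⊥-elim (is-nothing-just (proj₂ (proj₂ (Equivalence.to (same⇔ (ℓ x) (ℓ y)) xy))) (proj₁ (support yz)))
  transitive′ {x} {y} {z} (inj₂ xy) (inj₂ yz)
    with Equivalence.to (same⇔ (ℓ x) (ℓ y)) xy | Equivalence.to (same⇔ (ℓ y) (ℓ z)) yz
  ... | j , x-j , y-j | j′ , y-j′ , z-j′ =
    inj₂ (Equivalence.from (same⇔ (ℓ x) (ℓ z)) (j , x-j , trans z-j′ (trans (sym y-j′) y-j)))

join-cases : {r n : ℕ} {P : Fin (r + n) → Set} → (∀ a → P (join r n a)) → ∀ x → P x
join-cases {r} {n} {P} h x = subst P (join-splitAt r n x) (h (splitAt r x))

special<ordinary : {r n : ℕ} (i : Fin r) (u : Fin n) → toℕ (i ↑ˡ n) < toℕ (r ↑ʳ u)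
special<ordinary {r} {n} i u rewrite toℕ-↑ˡ i n | toℕ-↑ʳ r u = ≤-trans (toℕ<n i) (m≤m+n r (toℕ u))

ordinary<ordinary : {r n : ℕ} {w u : Fin n} → toℕ w < toℕ u → toℕ (r ↑ʳ w) < toℕ (r ↑ʳ u)
ordinary<ordinary {r} {w = w} {u} w<u rewrite toℕ-↑ʳ r w | toℕ-↑ʳ r u = +-monoʳ-< r w<u

ordinary<ordinary⁻ : {r n : ℕ} {w u : Fin n} → toℕ (r ↑ʳ w) < toℕ (r ↑ʳ u) → toℕ w < toℕ u
ordinary<ordinary⁻ {r} {w = w} {u} w<u rewrite toℕ-↑ʳ r w | toℕ-↑ʳ r u = +-cancelˡ-< r (toℕ w) (toℕ u) w<u

module _ {n r : ℕ} (c : Vec (Maybe (Fin r)) n) (N : BRel n) where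

  label : Fin r ⊎ Fin n → Maybe (Fin r)
  label (inj₁ i) = just i
  label (inj₂ u) = Vec.lookup c u

  ordinary : Fin r ⊎ Fin n → Fin r ⊎ Fin n → Bool
  ordinary (inj₂ u) (inj₂ v) = rel N u v
  ordinary _        _        = false

  glued : Fin r ⊎ Fin n → Fin r ⊎ Fin n → Bool
  glued a b = ordinary a b ∨ same (label a) (label b)

  glue : BRel (r + n)
  glue = tabulateRel (λ x y → glued (splitAt r x) (splitAt r y))

  rel-glue : ∀ a b → rel glue (join r n a) (join r n b) ≡ glued a b
  rel-glue a b = trans (rel-tabulateRel _ (join r n a) (join r n b))
                       (cong₂ glued (splitAt-join r n a) (splitAt-join r n b))

  special~ordinary : ∀ i u → T (rel glue (i ↑ˡ n) (r ↑ʳ u)) ⇔ (Vec.lookup c u ≡ just i)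
  special~ordinary i u = ⇔.trans (mk⇔ (subst T (rel-glue (inj₁ i) (inj₂ u))) (subst T (sym (rel-glue (inj₁ i) (inj₂ u)))))
                                 (same-justˡ i (Vec.lookup c u))

  ordinary-equivalence : IsEquivalenceOn (notInV c) (rel N) → IsEquivalenceOn (is-nothing ∘ label) ordinary
  ordinary-equivalence e = record
    { support    = λ {a} {b} → support′ {a} {b}
    ; reflexive  = λ {a} → reflexive′ {a}
    ; symmetric  = λ {a} {b} → symmetric′ {a} {b}
    ; transitive = λ {a} {b} {d} → transitive′ {a} {b} {d}
    }
    where
    open IsEquivalenceOn e
    support′ : ∀ {a b} → T (ordinary a b) → T (is-nothing (label a)) × T (is-nothing (label b))
    support′ {inj₂ _} {inj₂ _} uv = support uv
    reflexive′ : ∀ {a} → T (is-nothing (label a)) → T (ordinary a a)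
    reflexive′ {inj₂ _} u-unlabelled = reflexive u-unlabelled
    symmetric′ : ∀ {a b} → T (ordinary a b) → T (ordinary b a)
    symmetric′ {inj₂ _} {inj₂ _} uv = symmetric uv
    transitive′ : ∀ {a b d} → T (ordinary a b) → T (ordinary b d) → T (ordinary a d)
    transitive′ {inj₂ _} {inj₂ _} {inj₂ _} uv vw = transitive uv vw

  glue-equivalence : IsEquivalenceOn (notInV c) (rel N) → IsEquivalenceOn everywhere (rel glue)
  glue-equivalence e = equivalence-pullback (splitAt r) (rel-tabulateRel _)
                         (labelled-union-equivalence label ordinary (ordinary-equivalence e))

  ordinary-special : ∀ a j → ordinary a (inj₁ j) ≡ false
  ordinary-special (inj₁ _) j = refl
  ordinary-special (inj₂ _) j = refl

  blockSize-glue : ∀ a → blockSize glue (join r n a) ≡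
    countᶠ (λ j → same (label a) (just j)) + countᶠ (λ v → glued a (inj₂ v))
  blockSize-glue a = trans (countᶠ-split r n (rel glue (join r n a)))
    (cong₂ _+_ (countᶠ-cong (λ j → trans (rel-glue a (inj₁ j)) (cong (_∨ same (label a) (just j)) (ordinary-special a j))))
               (countᶠ-cong (λ v → rel-glue a (inj₂ v))))

  blockSize-labelled : ∀ a {i} → label a ≡ just i → (∀ b → ¬ T (ordinary a b)) →
    blockSize glue (join r n a) ≡ suc (countᶠ (inComponent c i))
  blockSize-labelled a {i} a-i alone = begin
    blockSize glue (join r n a)                                              ≡⟨ blockSize-glue a ⟩
    countᶠ (λ j → same (label a) (just j)) + countᶠ (λ v → glued a (inj₂ v)) ≡⟨ cong₂ _+_ specials ordinaries ⟩
    suc (countᶠ (inComponent c i))                                           ∎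
    where
    open ≡-Reasoning
    specials : countᶠ (λ j → same (label a) (just j)) ≡ 1
    specials = countᶠ-single _ i (Equivalence.from (same-justʳ (label a) i) a-i)
      (λ j a~j → just-injective (trans (sym (Equivalence.to (same-justʳ (label a) j) a~j)) a-i))
    ordinaries : countᶠ (λ v → glued a (inj₂ v)) ≡ countᶠ (inComponent c i)
    ordinaries = countᶠ-cong λ v → begin
      ordinary a (inj₂ v) ∨ same (label a) (Vec.lookup c v) ≡⟨ cong₂ _∨_ (T-ext (λ o → ⊥-elim (alone _ o)) ⊥-elim)
                                                                        (cong (λ l → same l (Vec.lookup c v)) a-i) ⟩
      same (just i) (Vec.lookup c v)                        ≡⟨ sym (inComponent-same c i v) ⟩
      inComponent c i v                                     ∎

  blockSize-unlabelled : ∀ u → Vec.lookup c u ≡ nothing → blockSize glue (r ↑ʳ u) ≡ blockSize N u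
  blockSize-unlabelled u u-nothing = begin
    blockSize glue (r ↑ʳ u)                                                           ≡⟨ blockSize-glue (inj₂ u) ⟩
    countᶠ (λ j → same (Vec.lookup c u) (just j)) + countᶠ (λ v → glued (inj₂ u) (inj₂ v))
                                                                                      ≡⟨ cong₂ _+_ specials ordinaries ⟩
    blockSize N u                                                                     ∎
    where
    open ≡-Reasoning
    specials : countᶠ (λ j → same (Vec.lookup c u) (just j)) ≡ 0
    specials = countᶠ-none _ λ j → subst (λ l → ¬ T (same l (just j))) (sym u-nothing) id
    ordinaries : countᶠ (λ v → glued (inj₂ u) (inj₂ v)) ≡ blockSize N u
    ordinaries = countᶠ-cong λ v → begin
      rel N u v ∨ same (Vec.lookup c u) (Vec.lookup c v) ≡⟨ cong (λ l → rel N u v ∨ same l (Vec.lookup c v)) u-nothing ⟩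
      rel N u v ∨ false                                  ≡⟨ ∨-identityʳ (rel N u v) ⟩
      rel N u v                                          ∎

  -- Every special point leads its block: earlier points are special and unrelated to it.
  special-leader : ∀ i → T (isBlockLeader everywhere glue (i ↑ˡ n))
  special-leader i = Equivalence.from (isBlockLeader⇔ everywhere glue (i ↑ˡ n)) (tt , join-cases earlier)
    where
    earlier : ∀ a → toℕ (join r n a) < toℕ (i ↑ˡ n) → ¬ T (rel glue (join r n a) (i ↑ˡ n))
    earlier (inj₁ j) j<i ji =
      <-irrefl (cong (λ l → toℕ (l ↑ˡ n)) (toWitness (subst T (rel-glue (inj₁ j) (inj₁ i)) ji))) j<i
    earlier (inj₂ w) w<i _  = <-asym w<i (special<ordinary i w)

  ordinary-leader : ∀ u → T (isBlockLeader everywhere glue (r ↑ʳ u)) ⇔ T (isBlockLeader (notInV c) N u)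
  ordinary-leader u = mk⇔
    (λ h → Equivalence.from leader-in-N (leads-in-N (proj₂ (Equivalence.to leader-in-glue h))))
    (λ h → Equivalence.from leader-in-glue (tt , join-cases (leads-in-glue (Equivalence.to leader-in-N h))))
    where
    leader-in-glue = isBlockLeader⇔ everywhere glue (r ↑ʳ u)
    leader-in-N = isBlockLeader⇔ (notInV c) N u
    leads-in-N : (∀ x → toℕ x < toℕ (r ↑ʳ u) → ¬ T (rel glue x (r ↑ʳ u))) →
      T (notInV c u) × (∀ w → toℕ w < toℕ u → ¬ T (rel N w u))
    leads-in-N no-earlier = unlabelled (Vec.lookup c u) refl , λ w w<u wu →
      no-earlier (r ↑ʳ w) (ordinary<ordinary w<u)
        (subst T (sym (rel-glue (inj₂ w) (inj₂ u))) (Equivalence.from T-∨ (inj₁ wu)))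
      where
      unlabelled : ∀ l → Vec.lookup c u ≡ l → T (notInV c u)
      unlabelled nothing  u-nothing = Equivalence.from is-nothing⇔ u-nothing
      unlabelled (just i) u-i = ⊥-elim (no-earlier (i ↑ˡ n) (special<ordinary i u) (Equivalence.from (special~ordinary i u) u-i))
    leads-in-glue : T (notInV c u) × (∀ w → toℕ w < toℕ u → ¬ T (rel N w u)) →
      ∀ a → toℕ (join r n a) < toℕ (r ↑ʳ u) → ¬ T (rel glue (join r n a) (r ↑ʳ u))
    leads-in-glue (u-unlabelled , _) (inj₁ j) _ ju =
      is-nothing-just (Equivalence.to (special~ordinary j u) ju) u-unlabelled
    leads-in-glue (u-unlabelled , no-earlier) (inj₂ w) w<u wu with Equivalence.to T-∨ (subst T (rel-glue (inj₂ w) (inj₂ u)) wu)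
    ... | inj₁ N-wu = no-earlier w (ordinary<ordinary⁻ w<u) N-wu
    ... | inj₂ w~u  =
      is-nothing-just (proj₂ (proj₂ (Equivalence.to (same⇔ (Vec.lookup c w) (Vec.lookup c u)) w~u))) u-unlabelled

  -- Each special point adds one block; the ordinary blocks are the blocks of N.
  numBlocks-glue : numBlocks everywhere glue ≡ r + numBlocks (notInV c) N
  numBlocks-glue = trans (countᶠ-split r n (isBlockLeader everywhere glue))
    (cong₂ _+_ (countᶠ-all _ special-leader)
               (countᶠ-cong λ u → T-ext (Equivalence.to (ordinary-leader u)) (Equivalence.from (ordinary-leader u))))

module _ {n r : ℕ} where

  labels : BRel (r + n) → Vec (Maybe (Fin r)) n
  labels M = Vec.tabulate (λ u → witness (λ i → rel M (i ↑ˡ n) (r ↑ʳ u)))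

  unlabelledPart : BRel (r + n) → BRel n
  unlabelledPart M = tabulateRel (λ u v → rel M (r ↑ʳ u) (r ↑ʳ v) ∧ notInV (labels M) u ∧ notInV (labels M) v)

  decompose : BRel (r + n) → CompPartPair n r
  decompose M = labels M , unlabelledPart M

  unlabelledPart⁻ : (M : BRel (r + n)) {u v : Fin n} → T (rel (unlabelledPart M) u v) →
    T (rel M (r ↑ʳ u) (r ↑ʳ v)) × T (notInV (labels M) u) × T (notInV (labels M) v)
  unlabelledPart⁻ M {u} {v} uv with ∧-elim {rel M (r ↑ʳ u) (r ↑ʳ v)} (subst T (rel-tabulateRel _ u v) uv)
  ... | muv , dudv = muv , ∧-elim {notInV (labels M) u} dudv

  unlabelledPart⁺ : (M : BRel (r + n)) {u v : Fin n} → T (rel M (r ↑ʳ u) (r ↑ʳ v)) →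
    T (notInV (labels M) u) → T (notInV (labels M) v) → T (rel (unlabelledPart M) u v)
  unlabelledPart⁺ M {u} {v} muv du dv =
    subst T (sym (rel-tabulateRel _ u v)) (∧-intro {rel M (r ↑ʳ u) (r ↑ʳ v)} muv (∧-intro {notInV (labels M) u} du dv))

  unlabelledPart-equivalence : (M : BRel (r + n)) → IsEquivalenceOn everywhere (rel M) →
    IsEquivalenceOn (notInV (labels M)) (rel (unlabelledPart M))
  unlabelledPart-equivalence M e = record
    { support    = λ uv → let _ , du , dv = unlabelledPart⁻ M uv in du , dv
    ; reflexive  = λ du → unlabelledPart⁺ M (reflexive tt) du du
    ; symmetric  = λ uv → let muv , du , dv = unlabelledPart⁻ M uv in unlabelledPart⁺ M (symmetric muv) dv du
    ; transitive = λ uv vw → let muv , du , _ = unlabelledPart⁻ M uv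
                                 mvw , _ , dw = unlabelledPart⁻ M vw
                             in unlabelledPart⁺ M (transitive muv mvw) du dw
    }
    where open IsEquivalenceOn e

  module _ (M : BRel (r + n)) (e : IsEquivalenceOn everywhere (rel M))
           (separated : ∀ {i j} → T (rel M (i ↑ˡ n) (j ↑ˡ n)) → i ≡ j) where
    open IsEquivalenceOn e

    labels-spec : ∀ u i → (Vec.lookup (labels M) u ≡ just i) ⇔ T (rel M (i ↑ˡ n) (r ↑ʳ u))
    labels-spec u i = mk⇔
      (λ u-i → witness-holds in-block-of (trans (sym (lookup∘tabulate _ u)) u-i))
      (λ iu → trans (lookup∘tabulate _ u) (witness-unique in-block-of one-block iu))
      where
      in-block-of = λ i → rel M (i ↑ˡ n) (r ↑ʳ u)
      one-block : ∀ {i j} → T (in-block-of i) → T (in-block-of j) → i ≡ j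
      one-block iu ju = separated (transitive iu (symmetric ju))

    glued-decomposition : ∀ a b → T (rel M (join r n a) (join r n b)) ⇔ T (glued (labels M) (unlabelledPart M) a b)
    glued-decomposition (inj₁ i) (inj₁ j) =
      mk⇔ (fromWitness ∘ separated)
          (λ i≡j → subst (λ j → T (rel M (i ↑ˡ n) (j ↑ˡ n))) (toWitness i≡j) (reflexive tt))
    glued-decomposition (inj₁ i) (inj₂ v) = ⇔.sym (⇔.trans (same-justˡ i _) (labels-spec v i))
    glued-decomposition (inj₂ u) (inj₁ j) =
      ⇔.trans (mk⇔ symmetric symmetric) (⇔.sym (⇔.trans (same-justʳ _ j) (labels-spec u j)))
    glued-decomposition (inj₂ u) (inj₂ v) = mk⇔ to from
      where
      c = labels M
      to : T (rel M (r ↑ʳ u) (r ↑ʳ v)) → T (rel (unlabelledPart M) u v ∨ same (Vec.lookup c u) (Vec.lookup c v))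
      to uv = Equivalence.from T-∨ (by-labels (Vec.lookup c u) refl (Vec.lookup c v) refl)
        where
        by-labels : ∀ lu → Vec.lookup c u ≡ lu → ∀ lv → Vec.lookup c v ≡ lv →
          T (rel (unlabelledPart M) u v) ⊎ T (same (Vec.lookup c u) (Vec.lookup c v))
        by-labels (just i) u-i _ _ =
          inj₂ (Equivalence.from (same⇔ _ _) (i , u-i , Equivalence.from (labels-spec v i)
                  (transitive (Equivalence.to (labels-spec u i) u-i) uv)))
        by-labels nothing u-nothing (just j) v-j = ⊥-elim (is-nothing-just u-j (Equivalence.from is-nothing⇔ u-nothing))
          where u-j = Equivalence.from (labels-spec u j) (transitive (Equivalence.to (labels-spec v j) v-j) (symmetric uv))
        by-labels nothing u-nothing nothing v-nothing =
          inj₁ (unlabelledPart⁺ M uv (Equivalence.from is-nothing⇔ u-nothing) (Equivalence.from is-nothing⇔ v-nothing))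
      from : T (rel (unlabelledPart M) u v ∨ same (Vec.lookup c u) (Vec.lookup c v)) → T (rel M (r ↑ʳ u) (r ↑ʳ v))
      from uv with Equivalence.to T-∨ uv
      ... | inj₁ N-uv = proj₁ (unlabelledPart⁻ M N-uv)
      ... | inj₂ u~v  = let j , u-j , v-j = Equivalence.to (same⇔ _ _) u~v in
        transitive (symmetric (Equivalence.to (labels-spec u j) u-j)) (Equivalence.to (labels-spec v j) v-j)

    glue-decompose : glue (labels M) (unlabelledPart M) ≡ M
    glue-decompose = BRel-ext (join-cases λ a → join-cases λ b →
      trans (rel-glue (labels M) (unlabelledPart M) a b)
            (T-ext (Equivalence.from (glued-decomposition a b)) (Equivalence.to (glued-decomposition a b))))

  decompose-glue : (c : Vec (Maybe (Fin r)) n) (N : BRel n) →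
    (∀ {u v} → T (rel N u v) → T (notInV c u) × T (notInV c v)) → decompose (glue c N) ≡ (c , N)
  decompose-glue c N support = cong₂ _,_ labels-glue (BRel-ext unlabelledPart-glue)
    where
    labels-glue : labels (glue c N) ≡ c
    labels-glue = Vec-ext λ u → trans (lookup∘tabulate _ u) (witness-of u (Vec.lookup c u) refl)
      where
      witness-of : ∀ u l → Vec.lookup c u ≡ l → witness (λ i → rel (glue c N) (i ↑ˡ n) (r ↑ʳ u)) ≡ l
      witness-of u (just j) u-j = witness-unique _
        (λ iu ju → just-injective (trans (sym (Equivalence.to (special~ordinary c N _ u) iu))
                                         (Equivalence.to (special~ordinary c N _ u) ju)))
        (Equivalence.from (special~ordinary c N j u) u-j)
      witness-of u nothing u-nothing = witness-none _ λ i iu →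
        is-nothing-just (trans (sym u-nothing) (Equivalence.to (special~ordinary c N i u) iu)) tt
    unlabelledPart-glue : ∀ u v → rel (unlabelledPart (glue c N)) u v ≡ rel N u v
    unlabelledPart-glue u v = T-ext to from
      where
      unlabelled≡ : ∀ w → notInV (labels (glue c N)) w ≡ notInV c w
      unlabelled≡ w = cong (λ c′ → notInV c′ w) labels-glue
      to : T (rel (unlabelledPart (glue c N)) u v) → T (rel N u v)
      to uv with unlabelledPart⁻ (glue c N) uv
      ... | glued-uv , du , _ with Equivalence.to T-∨ (subst T (rel-glue c N (inj₂ u) (inj₂ v)) glued-uv)
      ...   | inj₁ N-uv = N-uv
      ...   | inj₂ u~v  =
        ⊥-elim (is-nothing-just (proj₁ (proj₂ (Equivalence.to (same⇔ _ _) u~v))) (subst T (unlabelled≡ u) du))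
      from : T (rel N u v) → T (rel (unlabelledPart (glue c N)) u v)
      from N-uv = unlabelledPart⁺ (glue c N)
        (subst T (sym (rel-glue c N (inj₂ u) (inj₂ v))) (Equivalence.from T-∨ (inj₁ N-uv)))
        (subst T (sym (unlabelled≡ u)) (proj₁ (support N-uv)))
        (subst T (sym (unlabelled≡ v)) (proj₂ (support N-uv)))

-- Gluing a good pair gives an r-Stirling partition: the glued relation is an equivalence,
-- each special block {i} ∪ V_i has size |V_i| + 1 ∈ S, the other blocks are those of N,
-- and there are r + k blocks.
glue-stirling : {S : Subsetℕ} {n k r : ℕ} (c : Vec (Maybe (Fin r)) n) (N : BRel n) →
  IsGoodPair S n k r c N → IsStirlingPartition S n k r (glue c N)
glue-stirling {S} {n} {k} {r} c N good = record
  { equivalence = glue-equivalence c N equivalence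
  ; block-count = trans (numBlocks-glue c N) (trans (cong (r +_) block-count) (+-comm r k))
  ; block-sizes = join-cases sizes
  ; separated   = λ {i} {j} ij → toWitness (subst T (rel-glue c N (inj₁ i) (inj₁ j)) ij)
  }
  where
  open IsGoodPair good
  sizes : ∀ a → T (S (blockSize (glue c N) (join r n a)))
  sizes (inj₁ i) = subst (T ∘ S) (sym (blockSize-labelled c N (inj₁ i) refl (λ _ ()))) (component-sizes i)
  sizes (inj₂ u) = by-label (Vec.lookup c u) refl
    where
    by-label : ∀ l → Vec.lookup c u ≡ l → T (S (blockSize (glue c N) (r ↑ʳ u)))
    by-label (just i) u-i = subst (T ∘ S) (sym (blockSize-labelled c N (inj₂ u) u-i alone)) (component-sizes i)
      where
      alone : ∀ b → ¬ T (ordinary c N (inj₂ u) b)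
      alone (inj₂ v) uv = is-nothing-just u-i (proj₁ (IsEquivalenceOn.support equivalence uv))
    by-label nothing u-nothing = subst (T ∘ S) (sym (blockSize-unlabelled c N u u-nothing))
                                   (block-sizes (Equivalence.from is-nothing⇔ u-nothing))

-- Decomposing an r-Stirling partition gives a good pair: its sizes and block count are
-- read off from those of the partition, which is the glue of its decomposition.
decompose-good : {S : Subsetℕ} {n k r : ℕ} (M : BRel (r + n)) →
  IsStirlingPartition S n k r M → IsGoodPair S n k r (labels M) (unlabelledPart M)
decompose-good {S} {n} {k} {r} M stirling = record
  { component-sizes = λ i → subst (T ∘ S) (special-size i) (block-sizes (i ↑ˡ n))
  ; equivalence     = unlabelledPart-equivalence M equivalence
  ; block-count     = +-cancelˡ-≡ r _ _ (begin
      r + numBlocks (notInV c) N ≡⟨ sym (numBlocks-glue c N) ⟩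
      numBlocks everywhere (glue c N) ≡⟨ cong (numBlocks everywhere) reassembled ⟩
      numBlocks everywhere M ≡⟨ block-count ⟩
      k + r ≡⟨ +-comm k r ⟩
      r + k ∎)
  ; block-sizes     = λ {u} du → subst (T ∘ S) (ordinary-size u du) (block-sizes (r ↑ʳ u))
  }
  where
  open ≡-Reasoning
  open IsStirlingPartition stirling
  c = labels M
  N = unlabelledPart M
  reassembled : glue c N ≡ M
  reassembled = glue-decompose M equivalence separated
  special-size : ∀ i → blockSize M (i ↑ˡ n) ≡ suc (countᶠ (inComponent c i))
  special-size i = trans (cong (λ X → blockSize X (i ↑ˡ n)) (sym reassembled)) (blockSize-labelled c N (inj₁ i) refl (λ _ ()))
  ordinary-size : ∀ u → T (notInV c u) → blockSize M (r ↑ʳ u) ≡ blockSize N u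
  ordinary-size u du = trans (cong (λ X → blockSize X (r ↑ʳ u)) (sym reassembled))
                             (blockSize-unlabelled c N u (Equivalence.to is-nothing⇔ du))

-- Gluing and decomposing are mutually inverse between the r-Stirling partitions and the
-- good composition–partition pairs.
proposition5p1 : (S : Subsetℕ) → S 0 ≡ false → (n k r : ℕ) →
    rStirlingS S n k r ≡ numGoodPairs S n k r
proposition5p1 S _ n k r =
  count-bijection (allBRel-unique (r + n)) (allCompPartPairs-unique n r)
                  (allBRel-complete (r + n)) (allCompPartPairs-complete n r)
                  (isRStirlingPartition S n k r) (isGoodPair S n k r) decompose (uncurry glue)
                  (λ {M} → write-good (labels M) (unlabelledPart M) ∘ decompose-good M ∘ read-stirling M)
                  (λ { {c , N} → write-stirling (glue c N) ∘ glue-stirling c N ∘ read-good c N })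
                  (λ {M} h → let open IsStirlingPartition (read-stirling M h) in glue-decompose M equivalence separated)
                  (λ { {c , N} h → decompose-glue c N (IsEquivalenceOn.support (IsGoodPair.equivalence (read-good c N h))) })
  where
  read-stirling : ∀ M → T (isRStirlingPartition S n k r M) → IsStirlingPartition S n k r M
  read-stirling M = Equivalence.to (isRStirlingPartition⇔ S n k r M)
  write-stirling : ∀ M → IsStirlingPartition S n k r M → T (isRStirlingPartition S n k r M)
  write-stirling M = Equivalence.from (isRStirlingPartition⇔ S n k r M)
  read-good : ∀ c N → T (isGoodPair S n k r (c , N)) → IsGoodPair S n k r c N
  read-good c N = Equivalence.to (isGoodPair⇔ S n k r c N)
  write-good : ∀ c N → IsGoodPair S n k r c N → T (isGoodPair S n k r (c , N))
  write-good c N = Equivalence.from (isGoodPair⇔ S n k r c N)
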